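{- Let $G$ be a chordal graph with perfect elimination order $v_1,\ldots,v_n$, and for $0\le m\le n$ let $G_m$ be the subgraph of $G$ induced by $v_1,\ldots,v_m$. Let $S_G=\left[{G_m \brace k}\right]_{m,k=0}^n$ and $s_G=S_G^{ -1}$. Then for all $m,k\in\{0,\ldots,n\}$, the $(m,k)$ entry of $s_G$ has sign $(-1)^{m-k}$ (i.e. $(-1)^{m-k}$ times it is non-negative).
   Context: A graph is chordal if it contains no induced cycle of length four or more. An ordering $v_1,\ldots,v_n$ of the vertices is a perfect elimination order if for each $m$ the neighbours of $v_m$ among $v_1,\ldots,v_{m-1}$ form a clique. For a graph $H$ and integer $k$, the graph Stirling number of the second kind ${H \brace k}$ is the number of partitions of the vertex set of $H$ into $k$ non-empty independent sets (so ${G_0\brace 0}=1$ for the empty graph $G_0$). Matrices are indexed by $\{0,\ldots,n\}$; $S_G$ is lower triangular with ones on the diagonal, hence invertible. -}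

module Defs where

open import Data.Bool using (Bool; true; false; _∧_; if_then_else_)
open import Data.Nat as ℕ using (ℕ; zero; suc; _<_; _≤_; _%_; _<ᵇ_; _≡ᵇ_)
open import Data.Fin using (Fin; toℕ)
open import Data.List using (List; []; _∷_; [_]; map; concatMap; length; filter; allFin)
open import Data.Integer as ℤ using (ℤ; +_; 0ℤ; 1ℤ; -1ℤ)
open import Data.Product using (Σ; _×_; ∃)
open import Data.Sum using (_⊎_)
open import Function.Definitions using (Injective)
open import Relation.Binary.PropositionalEquality using (_≡_; _≢_)
open import Relation.Nullary using (¬_)
open import Data.Nat.Properties using (_<?_)
open import Relation.Nullary.Decidable using (⌊_⌋)

-- A finite simple graph on vertex set Fin n; the vertex i is v_{i+1},
-- so the natural order of Fin n is the given vertex ordering v_1,…,v_n.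
record Graph (n : ℕ) : Set where
  field
    adj       : Fin n → Fin n → Bool
    adj-sym   : ∀ a b → adj a b ≡ adj b a
    adj-irrefl : ∀ a → adj a a ≡ false
open Graph public

CycAdj : (r : ℕ) → Fin (4 ℕ.+ r) → Fin (4 ℕ.+ r) → Set
CycAdj r i j = (suc (toℕ i) % (4 ℕ.+ r) ≡ toℕ j) ⊎ (suc (toℕ j) % (4 ℕ.+ r) ≡ toℕ i)

InducedCycle : ∀ {n} → Graph n → (r : ℕ) → Set
InducedCycle {n} G r =
  Σ (Fin (4 ℕ.+ r) → Fin n) λ c →
    Injective _≡_ _≡_ c ×
    (∀ i j → (adj G (c i) (c j) ≡ true → CycAdj r i j) × (CycAdj r i j → adj G (c i) (c j) ≡ true))

Chordal : ∀ {n} → Graph n → Set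
Chordal G = ∀ r → ¬ InducedCycle G r

IsPEO : ∀ {n} → Graph n → Set
IsPEO G = ∀ a b c → toℕ b < toℕ a → toℕ c < toℕ a →
  adj G a b ≡ true → adj G a c ≡ true → b ≢ c → adj G b c ≡ true

allB : {A : Set} → (A → Bool) → List A → Bool
allB p [] = true
allB p (x ∷ xs) = p x ∧ allB p xs

countB : {A : Set} → (A → Bool) → List A → ℕ
countB p [] = 0
countB p (x ∷ xs) = if p x then suc (countB p xs) else countB p xs

-- Set partitions of a list of (distinct) elements, as lists of blocks.
insertEach : {A : Set} → A → List (List A) → List (List (List A))
insertEach x [] = []
insertEach x (b ∷ bs) = ((x ∷ b) ∷ bs) ∷ map (b ∷_) (insertEach x bs)

partitions : {A : Set} → List A → List (List (List A))
partitions [] = [ [] ]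
partitions (x ∷ xs) = concatMap (λ p → ([ x ] ∷ p) ∷ insertEach x p) (partitions xs)

independent : ∀ {n} → Graph n → List (Fin n) → Bool
independent G b = allB (λ x → allB (λ y → if adj G x y then false else true) b) b

vertsUpTo : ∀ {n} → ℕ → List (Fin n)
vertsUpTo {n} m = filter (λ i → toℕ i <? m) (allFin n)

-- Graph Stirling number {G_m brace k}: number of partitions of V(G_m)
-- into k (non-empty) independent sets of G_m (= of G, as G_m is induced).
stirling : ∀ {n} → Graph n → ℕ → ℕ → ℕ
stirling G m k =
  countB (λ p → ⌊ length p ℕ.≟ k ⌋ ∧ allB (independent G) p)
         (partitions (vertsUpTo m))

sumFin : ∀ {k} → (Fin k → ℤ) → ℤ
sumFin {zero} f = 0ℤ
sumFin {suc k} f = f Fin.zero ℤ.+ sumFin (λ i → f (Fin.suc i))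
  where import Data.Fin as Fin

S : ∀ {n} → Graph n → Fin (suc n) → Fin (suc n) → ℤ
S G m k = + stirling G (toℕ m) (toℕ k)

_⊗_ : ∀ {n} → (Fin n → Fin n → ℤ) → (Fin n → Fin n → ℤ) → Fin n → Fin n → ℤ
(A ⊗ B) i j = sumFin (λ l → A i l ℤ.* B l j)

idM : ∀ {n} → Fin n → Fin n → ℤ
idM i j = if ⌊ toℕ i ℕ.≟ toℕ j ⌋ then 1ℤ else 0ℤ

IsInverse : ∀ {n} → (Fin n → Fin n → ℤ) → (Fin n → Fin n → ℤ) → Set
IsInverse A B = (∀ i j → (A ⊗ B) i j ≡ idM i j) × (∀ i j → (B ⊗ A) i j ≡ idM i j)

module Submission where

-- Let c_m be the number of neighbours of v_(m+1) among v_1, …, v_m.  Those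
-- neighbours form a clique, so in a partition of V(G_m) into k independent
-- sets they lie in c_m distinct blocks, and v_(m+1) can join k - c_m blocks:
--     {G_(m+1) brace k} = {G_m brace k-1} + (k - c_m) {G_m brace k}.      (1)
-- Any matrix S with S(0,k) = [k = 0] obeying (1) has the explicit left
-- inverse T(0,k) = [k = 0], T(m+1,k) = T(m,k-1) + (c_k - m) T(m,k).  A left
-- inverse of a square matrix equals each right inverse, so s_G = T; and as
-- c_k ≤ k ≤ m, both terms of the recurrence for T have sign (-1)^(m+1-k).

open import Defs
open import Data.Nat using (ℕ)

module PartitionSums where

  open import Data.Nat using (ℕ; _+_; _*_)
  open import Data.Nat.Properties using (+-assoc; +-identityʳ; *-zeroʳ; *-distribˡ-+)
  open import Data.Nat.Tactic.RingSolver using (solve-∀)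
  open import Data.List using (List; []; _∷_; [_]; map; concatMap; _++_)
  open import Data.List.Relation.Binary.Permutation.Propositional as ↭ using (_↭_)
  open import Relation.Binary.PropositionalEquality
    using (_≡_; refl; sym; trans; cong; cong₂; module ≡-Reasoning)
  open ≡-Reasoning

  sumOver : {B : Set} → (B → ℕ) → List B → ℕ
  sumOver f [] = 0
  sumOver f (x ∷ xs) = f x + sumOver f xs

  sumOver-++ : {B : Set} (f : B → ℕ) (xs ys : List B) →
    sumOver f (xs ++ ys) ≡ sumOver f xs + sumOver f ys
  sumOver-++ f [] ys = refl
  sumOver-++ f (x ∷ xs) ys =
    trans (cong (f x +_) (sumOver-++ f xs ys)) (sym (+-assoc (f x) _ _))

  sumOver-map : {B C : Set} (f : C → ℕ) (g : B → C) (xs : List B) →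
    sumOver f (map g xs) ≡ sumOver (λ x → f (g x)) xs
  sumOver-map f g [] = refl
  sumOver-map f g (x ∷ xs) = cong (f (g x) +_) (sumOver-map f g xs)

  sumOver-concatMap : {B C : Set} (f : C → ℕ) (g : B → List C) (xs : List B) →
    sumOver f (concatMap g xs) ≡ sumOver (λ x → sumOver f (g x)) xs
  sumOver-concatMap f g [] = refl
  sumOver-concatMap f g (x ∷ xs) =
    trans (sumOver-++ f (g x) _) (cong (sumOver f (g x) +_) (sumOver-concatMap f g xs))

  sumOver-cong : {B : Set} {f g : B → ℕ} → (∀ x → f x ≡ g x) →
    (xs : List B) → sumOver f xs ≡ sumOver g xs
  sumOver-cong f≗g [] = refl
  sumOver-cong f≗g (x ∷ xs) = cong₂ _+_ (f≗g x) (sumOver-cong f≗g xs)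

  sumOver-+ : {B : Set} (f g : B → ℕ) (xs : List B) →
    sumOver (λ x → f x + g x) xs ≡ sumOver f xs + sumOver g xs
  sumOver-+ f g [] = refl
  sumOver-+ f g (x ∷ xs) =
    trans (cong (f x + g x +_) (sumOver-+ f g xs)) (interchange (f x) (g x) _ _)
    where
    interchange : ∀ a b c d → a + b + (c + d) ≡ a + c + (b + d)
    interchange = solve-∀

  sumOver-* : {B : Set} (a : ℕ) (f : B → ℕ) (xs : List B) →
    sumOver (λ x → a * f x) xs ≡ a * sumOver f xs
  sumOver-* a f [] = sym (*-zeroʳ a)
  sumOver-* a f (x ∷ xs) =
    trans (cong (a * f x +_) (sumOver-* a f xs)) (sym (*-distribˡ-+ a (f x) _))

  -- By definition,
  -- partitions (x ∷ xs) lists, for each partition p of xs, the partitions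
  -- 'addFront x p': x as a new singleton block, or x put in front of one
  -- block of p.  The statement about G_(m+1) needs the dual description of
  -- partitions (xs ++ [ y ]) through 'addBack y', which holds as long as
  -- the quantity being summed does not depend on the order of the blocks.
  module _ {A : Set} where

    Partition : Set
    Partition = List (List A)

    addFront : A → Partition → List Partition
    addFront x p = ([ x ] ∷ p) ∷ insertEach x p

    appendEach : A → Partition → List Partition
    appendEach y [] = []
    appendEach y (b ∷ bs) = ((b ++ [ y ]) ∷ bs) ∷ map (b ∷_) (appendEach y bs)

    addBack : A → Partition → List Partition
    addBack y p = ([ y ] ∷ p) ∷ appendEach y p

    BlockSymmetric : (Partition → ℕ) → Set
    BlockSymmetric w = ∀ {p q} → p ↭ q → w p ≡ w q

    insertEach-cons : (w : Partition → ℕ) (x : A) (b : List A) (p : Partition) →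
      sumOver w (insertEach x (b ∷ p)) ≡ w ((x ∷ b) ∷ p) + sumOver (λ q → w (b ∷ q)) (insertEach x p)
    insertEach-cons w x b p = cong (w ((x ∷ b) ∷ p) +_) (sumOver-map w (b ∷_) (insertEach x p))

    appendEach-cons : (w : Partition → ℕ) (y : A) (b : List A) (p : Partition) →
      sumOver w (appendEach y (b ∷ p)) ≡ w ((b ++ [ y ]) ∷ p) + sumOver (λ q → w (b ∷ q)) (appendEach y p)
    appendEach-cons w y b p = cong (w ((b ++ [ y ]) ∷ p) +_) (sumOver-map w (b ∷_) (appendEach y p))

    insertEach-↭ : ∀ x {w} → BlockSymmetric w → BlockSymmetric (λ p → sumOver w (insertEach x p))
    insertEach-↭ x w-sym ↭.refl = refl
    insertEach-↭ x {w} w-sym (↭.prep {p} {q} b p↭q) = begin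
      sumOver w (insertEach x (b ∷ p))                          ≡⟨ insertEach-cons w x b p ⟩
      w ((x ∷ b) ∷ p) + sumOver (λ r → w (b ∷ r)) (insertEach x p)
        ≡⟨ cong₂ _+_ (w-sym (↭.prep (x ∷ b) p↭q))
                     (insertEach-↭ x (λ r↭s → w-sym (↭.prep b r↭s)) p↭q) ⟩
      w ((x ∷ b) ∷ q) + sumOver (λ r → w (b ∷ r)) (insertEach x q) ≡⟨ insertEach-cons w x b q ⟨
      sumOver w (insertEach x (b ∷ q))                          ∎
    insertEach-↭ x {w} w-sym (↭.swap {p} {q} b c p↭q) = begin
      sumOver w (insertEach x (b ∷ c ∷ p))
        ≡⟨ trans (insertEach-cons w x b (c ∷ p)) (cong (w ((x ∷ b) ∷ c ∷ p) +_) (insertEach-cons _ x c p)) ⟩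
      w ((x ∷ b) ∷ c ∷ p) + (w (b ∷ (x ∷ c) ∷ p) + sumOver (λ r → w (b ∷ c ∷ r)) (insertEach x p))
        ≡⟨ cong₂ _+_ (w-sym (↭.swap (x ∷ b) c p↭q)) (cong₂ _+_ (w-sym (↭.swap b (x ∷ c) p↭q))
             (trans (insertEach-↭ x (λ r↭s → w-sym (↭.prep b (↭.prep c r↭s))) p↭q)
                    (sumOver-cong (λ r → w-sym (↭.swap b c ↭.refl)) (insertEach x q)))) ⟩
      w (c ∷ (x ∷ b) ∷ q) + (w ((x ∷ c) ∷ b ∷ q) + sumOver (λ r → w (c ∷ b ∷ r)) (insertEach x q))
        ≡⟨ exchange (w (c ∷ (x ∷ b) ∷ q)) (w ((x ∷ c) ∷ b ∷ q)) _ ⟩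
      w ((x ∷ c) ∷ b ∷ q) + (w (c ∷ (x ∷ b) ∷ q) + sumOver (λ r → w (c ∷ b ∷ r)) (insertEach x q))
        ≡⟨ trans (insertEach-cons w x c (b ∷ q)) (cong (w ((x ∷ c) ∷ b ∷ q) +_) (insertEach-cons _ x b q)) ⟨
      sumOver w (insertEach x (c ∷ b ∷ q)) ∎
      where
      exchange : ∀ a b c → a + (b + c) ≡ b + (a + c)
      exchange = solve-∀
    insertEach-↭ x w-sym (↭.trans p↭q q↭r) = trans (insertEach-↭ x w-sym p↭q) (insertEach-↭ x w-sym q↭r)

    -- Inserting x at the front of a block and appending y at the back of a
    -- block are independent choices, so the two double sums agree.
    insertEach-appendEach-comm : ∀ x y (w : Partition → ℕ) (p : Partition) →
      sumOver (λ q → sumOver w (insertEach x q)) (appendEach y p) ≡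
      sumOver (λ q → sumOver w (appendEach y q)) (insertEach x p)
    insertEach-appendEach-comm x y w [] = refl
    insertEach-appendEach-comm x y w (b ∷ p) = begin
      sumOver (λ q → sumOver w (insertEach x q)) (appendEach y (b ∷ p))
        ≡⟨ appendEach-cons _ y b p ⟩
      sumOver w (insertEach x ((b ++ [ y ]) ∷ p)) + sumOver (λ q → sumOver w (insertEach x (b ∷ q))) (appendEach y p)
        ≡⟨ cong₂ _+_ (insertEach-cons w x (b ++ [ y ]) p)
             (trans (sumOver-cong (λ q → insertEach-cons w x b q) (appendEach y p)) (sumOver-+ _ _ (appendEach y p))) ⟩
      (both + yOnly) + (xOnly + sumOver (λ q → sumOver (λ r → w (b ∷ r)) (insertEach x q)) (appendEach y p))
        ≡⟨ cong (λ z → (both + yOnly) + (xOnly + z)) (insertEach-appendEach-comm x y (λ r → w (b ∷ r)) p) ⟩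
      (both + yOnly) + (xOnly + neither)
        ≡⟨ interchange both yOnly xOnly neither ⟩
      (both + xOnly) + (yOnly + neither)
        ≡⟨ cong₂ _+_ (appendEach-cons w y (x ∷ b) p)
             (trans (sumOver-cong (λ q → appendEach-cons w y b q) (insertEach x p)) (sumOver-+ _ _ (insertEach x p))) ⟨
      sumOver w (appendEach y ((x ∷ b) ∷ p)) + sumOver (λ q → sumOver w (appendEach y (b ∷ q))) (insertEach x p)
        ≡⟨ insertEach-cons _ x b p ⟨
      sumOver (λ q → sumOver w (appendEach y q)) (insertEach x (b ∷ p)) ∎
      where
      both yOnly xOnly neither : ℕ
      both = w ((x ∷ b ++ [ y ]) ∷ p)
      yOnly = sumOver (λ q → w ((b ++ [ y ]) ∷ q)) (insertEach x p)
      xOnly = sumOver (λ q → w ((x ∷ b) ∷ q)) (appendEach y p)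
      neither = sumOver (λ q → sumOver (λ r → w (b ∷ r)) (appendEach y q)) (insertEach x p)
      interchange : ∀ a b c d → a + b + (c + d) ≡ a + c + (b + d)
      interchange = solve-∀

    addFront-↭ : ∀ x {w} → BlockSymmetric w → BlockSymmetric (λ p → sumOver w (addFront x p))
    addFront-↭ x w-sym p↭q = cong₂ _+_ (w-sym (↭.prep [ x ] p↭q)) (insertEach-↭ x w-sym p↭q)

    addFront-addBack-comm : ∀ x y {w} → BlockSymmetric w → ∀ p →
      sumOver (λ q → sumOver w (addFront x q)) (addBack y p) ≡
      sumOver (λ q → sumOver w (addBack y q)) (addFront x p)
    addFront-addBack-comm x y {w} w-sym p = begin
      (singletons + sumOver w (insertEach x ([ y ] ∷ p))) +
        sumOver (λ q → w ([ x ] ∷ q) + sumOver w (insertEach x q)) (appendEach y p)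
        ≡⟨ cong₂ _+_ (cong (singletons +_) (insertEach-cons w x [ y ] p)) (sumOver-+ _ _ (appendEach y p)) ⟩
      (singletons + (pair + yNew)) + (xNew + sumOver (λ q → sumOver w (insertEach x q)) (appendEach y p))
        ≡⟨ cong (λ z → (singletons + (pair + yNew)) + (xNew + z)) (insertEach-appendEach-comm x y w p) ⟩
      (singletons + (pair + yNew)) + (xNew + intoBlocks)
        ≡⟨ rearrange singletons pair yNew xNew intoBlocks ⟩
      (singletons + (pair + xNew)) + (yNew + intoBlocks)
        ≡⟨ cong₂ _+_ (cong₂ _+_ (w-sym (↭.swap [ y ] [ x ] ↭.refl)) (appendEach-cons w y [ x ] p))
                     (sumOver-+ _ _ (insertEach x p)) ⟨
      (w ([ y ] ∷ [ x ] ∷ p) + sumOver w (appendEach y ([ x ] ∷ p))) +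
        sumOver (λ q → w ([ y ] ∷ q) + sumOver w (appendEach y q)) (insertEach x p) ∎
      where
      singletons pair xNew yNew intoBlocks : ℕ
      singletons = w ([ x ] ∷ [ y ] ∷ p)
      pair = w ((x ∷ [ y ]) ∷ p)
      xNew = sumOver (λ q → w ([ x ] ∷ q)) (appendEach y p)
      yNew = sumOver (λ q → w ([ y ] ∷ q)) (insertEach x p)
      intoBlocks = sumOver (λ q → sumOver w (appendEach y q)) (insertEach x p)
      rearrange : ∀ a b c d e → a + (b + c) + (d + e) ≡ a + (b + d) + (c + e)
      rearrange = solve-∀

    partitions-snoc : ∀ (xs : List A) y {w} → BlockSymmetric w →
      sumOver w (partitions (xs ++ [ y ])) ≡ sumOver (λ p → sumOver w (addBack y p)) (partitions xs)
    partitions-snoc [] y w-sym = sym (+-identityʳ _)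
    partitions-snoc (x ∷ xs) y {w} w-sym = begin
      sumOver w (concatMap (addFront x) (partitions (xs ++ [ y ])))
        ≡⟨ sumOver-concatMap w (addFront x) (partitions (xs ++ [ y ])) ⟩
      sumOver (λ q → sumOver w (addFront x q)) (partitions (xs ++ [ y ]))
        ≡⟨ partitions-snoc xs y (addFront-↭ x w-sym) ⟩
      sumOver (λ p → sumOver (λ q → sumOver w (addFront x q)) (addBack y p)) (partitions xs)
        ≡⟨ sumOver-cong (addFront-addBack-comm x y w-sym) (partitions xs) ⟩
      sumOver (λ p → sumOver (λ q → sumOver w (addBack y q)) (addFront x p)) (partitions xs)
        ≡⟨ sumOver-concatMap (λ q → sumOver w (addBack y q)) (addFront x) (partitions xs) ⟨
      sumOver (λ q → sumOver w (addBack y q)) (concatMap (addFront x) (partitions xs)) ∎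

module VertexLists where

  open import Data.Bool using (true; false)
  open import Data.Nat as ℕ using (ℕ; zero; suc; _<_; _≤_; z≤n; s≤s)
  open import Data.Nat.Properties using (_<?_; <⇒≤; +-comm)
  open import Data.Fin using (Fin; toℕ; fromℕ<) renaming (zero to fzero; suc to fsuc)
  open import Data.Fin.Properties using (toℕ-fromℕ<)
  open import Data.List using (List; []; _∷_; [_]; map; length; _++_; filter; allFin)
  open import Data.List.Properties using (map-++; map-tabulate; length-++)
  open import Data.List.Membership.Propositional using (_∈_)
  open import Data.List.Membership.Propositional.Properties using (∈-filter⁻)
  open import Data.List.Relation.Unary.Unique.Propositional using (Unique)
  open import Data.List.Relation.Unary.Unique.Propositional.Properties using (filter⁺; allFin⁺)
  open import Data.Product using (proj₂)
  open import Relation.Binary.PropositionalEquality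
    using (_≡_; refl; sym; trans; cong; module ≡-Reasoning)
  open ≡-Reasoning

  below : ∀ {n} → ℕ → List (Fin n) → List (Fin n)
  below m = filter (λ i → toℕ i <? m)

  below-zero : ∀ {n} (xs : List (Fin n)) → below 0 xs ≡ []
  below-zero [] = refl
  below-zero (x ∷ xs) = below-zero xs

  below-suc : ∀ {n} m (xs : List (Fin n)) → below (suc m) (map fsuc xs) ≡ map fsuc (below m xs)
  below-suc m [] = refl
  below-suc m (x ∷ xs) with toℕ x ℕ.<ᵇ m
  ... | true = cong (fsuc x ∷_) (below-suc m xs)
  ... | false = below-suc m xs

  vertsUpTo-zero : ∀ n → vertsUpTo {n} 0 ≡ []
  vertsUpTo-zero n = below-zero (allFin n)

  vertsUpTo-suc : ∀ n m → vertsUpTo {suc n} (suc m) ≡ fzero ∷ map fsuc (vertsUpTo {n} m)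
  vertsUpTo-suc n m =
    trans (cong (λ xs → below (suc m) (fzero ∷ xs)) (sym (map-tabulate (λ i → i) fsuc)))
          (cong (fzero ∷_) (below-suc m (allFin n)))

  vertsUpTo-snoc : ∀ n m (m<n : m < n) → vertsUpTo {n} (suc m) ≡ vertsUpTo {n} m ++ [ fromℕ< m<n ]
  vertsUpTo-snoc (suc n) zero (s≤s z≤n)
    rewrite vertsUpTo-suc n 0 | vertsUpTo-zero n | vertsUpTo-zero (suc n) = refl
  vertsUpTo-snoc (suc n) (suc m) (s≤s m<n) = begin
    vertsUpTo (suc (suc m))                         ≡⟨ vertsUpTo-suc n (suc m) ⟩
    fzero ∷ map fsuc (vertsUpTo (suc m))            ≡⟨ cong (λ xs → fzero ∷ map fsuc xs) (vertsUpTo-snoc n m m<n) ⟩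
    fzero ∷ map fsuc (vertsUpTo m ++ [ fromℕ< m<n ]) ≡⟨ cong (fzero ∷_) (map-++ fsuc (vertsUpTo m) [ fromℕ< m<n ]) ⟩
    fzero ∷ map fsuc (vertsUpTo m) ++ [ fsuc (fromℕ< m<n) ] ≡⟨ cong (_++ [ fsuc (fromℕ< m<n) ]) (vertsUpTo-suc n m) ⟨
    vertsUpTo (suc m) ++ [ fromℕ< (s≤s m<n) ]      ∎

  length-vertsUpTo : ∀ n m → m ≤ n → length (vertsUpTo {n} m) ≡ m
  length-vertsUpTo n zero _ rewrite vertsUpTo-zero n = refl
  length-vertsUpTo n (suc m) m<n
    rewrite vertsUpTo-snoc n m m<n | length-++ (vertsUpTo {n} m) {[ fromℕ< m<n ]}
          | length-vertsUpTo n m (<⇒≤ m<n) = +-comm m 1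

  vertsUpTo-unique : ∀ n m → Unique (vertsUpTo {n} m)
  vertsUpTo-unique n m = filter⁺ (λ i → toℕ i <? m) (allFin⁺ n)

  vertsUpTo-precede : ∀ n m (m<n : m < n) a → a ∈ vertsUpTo {n} m → toℕ a < toℕ (fromℕ< m<n)
  vertsUpTo-precede n m m<n a a∈ rewrite toℕ-fromℕ< m<n =
    proj₂ (∈-filter⁻ (λ i → toℕ i <? m) {xs = allFin n} a∈)

module BooleanCounting where

  open import Data.Bool using (Bool; true; false; _∧_)
  open import Data.Bool.Properties using (∧-assoc; ∧-zeroʳ; ∧-conicalˡ; ∧-conicalʳ)
  open import Data.Nat using (ℕ; suc; _*_)
  open import Data.Nat.Properties using (+-identityʳ)
  open import Data.List using (List; []; _∷_; _++_)
  open import Data.List.Membership.Propositional using (_∈_)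
  open import Data.List.Relation.Unary.Any using (here; there)
  open import Data.List.Relation.Binary.Permutation.Propositional as ↭ using (_↭_)
  open import Relation.Binary.PropositionalEquality using (_≡_; refl; sym; trans; cong; cong₂)
  open PartitionSums using (sumOver)

  indicator : Bool → ℕ
  indicator true = 1
  indicator false = 0

  indicator-∧ : ∀ a b → indicator (a ∧ b) ≡ indicator a * indicator b
  indicator-∧ true b = sym (+-identityʳ (indicator b))
  indicator-∧ false b = refl

  countB-sumOver : {A : Set} (f : A → Bool) (xs : List A) → countB f xs ≡ sumOver (λ x → indicator (f x)) xs
  countB-sumOver f [] = refl
  countB-sumOver f (x ∷ xs) with f x
  ... | true = cong suc (countB-sumOver f xs)
  ... | false = countB-sumOver f xs

  module _ {A : Set} where

    allB-++ : (f : A → Bool) (xs ys : List A) → allB f (xs ++ ys) ≡ allB f xs ∧ allB f ys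
    allB-++ f [] ys = refl
    allB-++ f (x ∷ xs) ys = trans (cong (f x ∧_) (allB-++ f xs ys)) (sym (∧-assoc (f x) _ _))

    allB-cong : {f g : A → Bool} → (∀ x → f x ≡ g x) → (xs : List A) → allB f xs ≡ allB g xs
    allB-cong f≗g [] = refl
    allB-cong f≗g (x ∷ xs) = cong₂ _∧_ (f≗g x) (allB-cong f≗g xs)

    allB-∧ : (f g : A → Bool) (xs : List A) → allB (λ x → f x ∧ g x) xs ≡ allB f xs ∧ allB g xs
    allB-∧ f g [] = refl
    allB-∧ f g (x ∷ xs) = trans (cong ((f x ∧ g x) ∧_) (allB-∧ f g xs)) (interchange (f x) (g x) _ _)
      where
      interchange : ∀ a b c d → (a ∧ b) ∧ (c ∧ d) ≡ (a ∧ c) ∧ (b ∧ d)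
      interchange true true c d = refl
      interchange true false c d = sym (∧-zeroʳ c)
      interchange false b c d = refl

    allB-↭ : (f : A → Bool) {xs ys : List A} → xs ↭ ys → allB f xs ≡ allB f ys
    allB-↭ f ↭.refl = refl
    allB-↭ f (↭.prep x xs↭ys) = cong (f x ∧_) (allB-↭ f xs↭ys)
    allB-↭ f (↭.swap x y xs↭ys) = trans (cong (λ b → f x ∧ (f y ∧ b)) (allB-↭ f xs↭ys)) (exchange (f x) (f y) _)
      where
      exchange : ∀ a b c → a ∧ (b ∧ c) ≡ b ∧ (a ∧ c)
      exchange true b c = refl
      exchange false b c = sym (∧-zeroʳ b)
    allB-↭ f (↭.trans xs↭ys ys↭zs) = trans (allB-↭ f xs↭ys) (allB-↭ f ys↭zs)

    allB-∈ : {f : A → Bool} {xs : List A} {a : A} → allB f xs ≡ true → a ∈ xs → f a ≡ true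
    allB-∈ {f} {x ∷ xs} all (here refl) = ∧-conicalˡ (f x) _ all
    allB-∈ {f} {x ∷ xs} all (there a∈) = allB-∈ (∧-conicalʳ (f x) _ all) a∈

    allB-intro : {f : A → Bool} (xs : List A) → (∀ a → a ∈ xs → f a ≡ true) → allB f xs ≡ true
    allB-intro [] holds = refl
    allB-intro (x ∷ xs) holds rewrite holds x (here refl) = allB-intro xs (λ a a∈ → holds a (there a∈))

module NatEquality where

  open import Data.Nat using (suc; _≟_)
  open import Relation.Nullary.Decidable using (⌊_⌋; isYes≗does)
  open import Relation.Binary.PropositionalEquality using (_≡_; sym; trans)

  ≟-suc : ∀ a b → ⌊ suc a ≟ suc b ⌋ ≡ ⌊ a ≟ b ⌋
  ≟-suc a b = trans (isYes≗does (suc a ≟ suc b)) (sym (isYes≗does (a ≟ b)))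

module StirlingRecurrence {n : ℕ} (G : Graph n) where

  open import Data.Bool using (Bool; true; false; _∧_; if_then_else_)
  open import Data.Bool.Properties using (∧-identityʳ; ∧-zeroʳ; ∧-conicalˡ; ∧-conicalʳ)
  open import Data.Nat as ℕ using (ℕ; zero; suc; _+_; _*_; _<_; _≤_; z≤n; s≤s)
  open import Data.Nat.Properties
    using (_<?_; +-identityʳ; +-assoc; +-comm; +-suc; *-assoc; *-comm; *-zeroʳ; <-irrelevant; <⇒≤;
           m≤n⇒m≤1+n; ≤-trans; ≤-reflexive)
  open import Data.Nat.Tactic.RingSolver using (solve-∀)
  open import Data.Fin using (Fin; toℕ; fromℕ<)
  open import Data.List using (List; []; _∷_; [_]; map; length; _++_; concatMap)
  open import Data.List.Relation.Binary.Permutation.Propositional.Properties using (↭-length)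
  open import Data.List.Membership.Propositional using (_∈_)
  open import Data.List.Relation.Unary.Any using (here; there)
  open import Data.List.Relation.Unary.All using (lookup)
  open import Data.List.Relation.Unary.AllPairs using (_∷_)
  open import Data.List.Relation.Unary.Unique.Propositional using (Unique)
  open import Data.Product using (Σ; _×_; _,_)
  open import Data.Sum using (_⊎_; inj₁; inj₂)
  open import Data.Empty using (⊥; ⊥-elim)
  open import Relation.Nullary using (yes; no)
  open import Relation.Nullary.Decidable using (⌊_⌋)
  open import Relation.Binary.PropositionalEquality
    using (_≡_; refl; sym; trans; cong; cong₂; module ≡-Reasoning)
  open ≡-Reasoning
  open PartitionSums
  open BooleanCounting
  open VertexLists
  open NatEquality

  Blocks : Set
  Blocks = Partition {Fin n}

  nonadjacent : Fin n → Fin n → Bool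
  nonadjacent x z = if adj G x z then false else true

  nonadjacent-sym : ∀ x z → nonadjacent x z ≡ nonadjacent z x
  nonadjacent-sym x z rewrite adj-sym G x z = refl

  nonadjacent-self : ∀ x → nonadjacent x x ≡ true
  nonadjacent-self x rewrite adj-irrefl G x = refl

  proper : Blocks → Bool
  proper = allB (independent G)

  independent-snoc : ∀ b y → independent G (b ++ [ y ]) ≡ independent G b ∧ allB (nonadjacent y) b
  independent-snoc b y = begin
    allB (λ x → allB (nonadjacent x) (b ++ [ y ])) (b ++ [ y ])
      ≡⟨ allB-++ (λ x → allB (nonadjacent x) (b ++ [ y ])) b [ y ] ⟩
    allB (λ x → allB (nonadjacent x) (b ++ [ y ])) b ∧ (allB (nonadjacent y) (b ++ [ y ]) ∧ true)
      ≡⟨ cong₂ _∧_ (trans (allB-cong (λ x → allB-++ (nonadjacent x) b [ y ]) b)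
                          (allB-∧ (λ x → allB (nonadjacent x) b) (λ x → nonadjacent x y ∧ true) b))
                   (cong (_∧ true) (allB-++ (nonadjacent y) b [ y ])) ⟩
    (independent G b ∧ allB (λ x → nonadjacent x y ∧ true) b) ∧ ((allB (nonadjacent y) b ∧ (nonadjacent y y ∧ true)) ∧ true)
      ≡⟨ cong₂ (λ u v → (independent G b ∧ u) ∧ ((allB (nonadjacent y) b ∧ (v ∧ true)) ∧ true))
           (allB-cong (λ x → trans (∧-identityʳ _) (nonadjacent-sym x y)) b) (nonadjacent-self y) ⟩
    (independent G b ∧ allB (nonadjacent y) b) ∧ ((allB (nonadjacent y) b ∧ true) ∧ true)
      ≡⟨ absorb (independent G b) (allB (nonadjacent y) b) ⟩
    independent G b ∧ allB (nonadjacent y) b ∎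
    where
    absorb : ∀ i f → (i ∧ f) ∧ ((f ∧ true) ∧ true) ≡ i ∧ f
    absorb true true = refl
    absorb true false = refl
    absorb false f = refl

  independent-tail : ∀ z b → independent G (z ∷ b) ≡ true → independent G b ≡ true
  independent-tail z b indep = ∧-conicalʳ _ _
    (trans (sym (allB-∧ (λ x → nonadjacent x z) (λ x → allB (nonadjacent x) b) b))
           (∧-conicalʳ (nonadjacent z z ∧ allB (nonadjacent z) b) _ indep))

  independent-head : ∀ z b → independent G (z ∷ b) ≡ true → allB (nonadjacent z) b ≡ true
  independent-head z b indep = ∧-conicalʳ (nonadjacent z z) _ (∧-conicalˡ _ _ indep)

  freeBlocks : Fin n → Blocks → ℕ
  freeBlocks y = sumOver (λ b → indicator (allB (nonadjacent y) b))

  appendEach-proper : ∀ y (g : ℕ → ℕ) p →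
    sumOver (λ q → indicator (proper q) * g (length q)) (appendEach y p) ≡
    indicator (proper p) * freeBlocks y p * g (length p)
  appendEach-proper y g [] = refl
  appendEach-proper y g (b ∷ p) = begin
    indicator (independent G (b ++ [ y ]) ∧ proper p) * g (suc (length p)) +
      sumOver (λ q → indicator (proper q) * g (length q)) (map (b ∷_) (appendEach y p))
      ≡⟨ cong₂ _+_ (cong (λ u → indicator (u ∧ proper p) * g (suc (length p))) (independent-snoc b y))
                   (sumOver-map _ (b ∷_) (appendEach y p)) ⟩
    indicator ((ib ∧ fb) ∧ proper p) * g (suc (length p)) +
      sumOver (λ q → indicator (ib ∧ proper q) * g (suc (length q))) (appendEach y p)
      ≡⟨ cong₂ _+_ (cong (_* g (suc (length p))) (trans (indicator-∧ (ib ∧ fb) (proper p)) (cong (_* indicator (proper p)) (indicator-∧ ib fb))))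
                   (sumOver-cong (λ q → trans (cong (_* g (suc (length q))) (indicator-∧ ib (proper q))) (*-assoc (indicator ib) _ _)) (appendEach y p)) ⟩
    indicator ib * indicator fb * indicator (proper p) * g (suc (length p)) +
      sumOver (λ q → indicator ib * (indicator (proper q) * g (suc (length q)))) (appendEach y p)
      ≡⟨ cong (indicator ib * indicator fb * indicator (proper p) * g (suc (length p)) +_)
           (trans (sumOver-* (indicator ib) _ (appendEach y p)) (cong (indicator ib *_) (appendEach-proper y (λ l → g (suc l)) p))) ⟩
    indicator ib * indicator fb * indicator (proper p) * g (suc (length p)) +
      indicator ib * (indicator (proper p) * freeBlocks y p * g (suc (length p)))
      ≡⟨ collect (indicator ib) (indicator fb) (indicator (proper p)) (g (suc (length p))) (freeBlocks y p) ⟩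
    indicator ib * indicator (proper p) * (indicator fb + freeBlocks y p) * g (suc (length p))
      ≡⟨ cong (λ u → u * (indicator fb + freeBlocks y p) * g (suc (length p))) (indicator-∧ ib (proper p)) ⟨
    indicator (ib ∧ proper p) * (indicator fb + freeBlocks y p) * g (suc (length p)) ∎
    where
    ib fb : Bool
    ib = independent G b
    fb = allB (nonadjacent y) b
    collect : ∀ i f a h r → i * f * a * h + i * (a * r * h) ≡ i * a * (f + r) * h
    collect = solve-∀

  data Ins (z : Fin n) : Blocks → Blocks → Set where
    here  : ∀ {b p} → Ins z (b ∷ p) ((z ∷ b) ∷ p)
    there : ∀ {b p q} → Ins z p q → Ins z (b ∷ p) (b ∷ q)

  data IsPartition : List (Fin n) → Blocks → Set where
    nil       : IsPartition [] []
    singleton : ∀ {z L p} → IsPartition L p → IsPartition (z ∷ L) ([ z ] ∷ p)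
    insert    : ∀ {z L p q} → IsPartition L p → Ins z p q → IsPartition (z ∷ L) q

  sumOver-insertEach-cong : ∀ z {f g : Blocks → ℕ} p → (∀ q → Ins z p q → f q ≡ g q) →
    sumOver f (insertEach z p) ≡ sumOver g (insertEach z p)
  sumOver-insertEach-cong z [] agree = refl
  sumOver-insertEach-cong z {f} {g} (b ∷ p) agree = cong₂ _+_ (agree _ here) (begin
    sumOver f (map (b ∷_) (insertEach z p))      ≡⟨ sumOver-map f (b ∷_) (insertEach z p) ⟩
    sumOver (λ q → f (b ∷ q)) (insertEach z p)
      ≡⟨ sumOver-insertEach-cong z p (λ q ins → agree (b ∷ q) (there ins)) ⟩
    sumOver (λ q → g (b ∷ q)) (insertEach z p)   ≡⟨ sumOver-map g (b ∷_) (insertEach z p) ⟨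
    sumOver g (map (b ∷_) (insertEach z p))      ∎)

  sumOver-partitions-cong : ∀ L {f g : Blocks → ℕ} → (∀ p → IsPartition L p → f p ≡ g p) →
    sumOver f (partitions L) ≡ sumOver g (partitions L)
  sumOver-partitions-cong [] agree = cong (_+ 0) (agree [] nil)
  sumOver-partitions-cong (z ∷ L) {f} {g} agree = begin
    sumOver f (concatMap (addFront z) (partitions L))  ≡⟨ sumOver-concatMap f (addFront z) (partitions L) ⟩
    sumOver (λ p → sumOver f (addFront z p)) (partitions L)
      ≡⟨ sumOver-partitions-cong L (λ p isP → cong₂ _+_ (agree _ (singleton isP))
           (sumOver-insertEach-cong z p (λ q ins → agree q (insert isP ins)))) ⟩
    sumOver (λ p → sumOver g (addFront z p)) (partitions L)  ≡⟨ sumOver-concatMap g (addFront z) (partitions L) ⟨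
    sumOver g (concatMap (addFront z) (partitions L))  ∎

  Ins-length : ∀ {z p q} → Ins z p q → length q ≡ length p
  Ins-length here = refl
  Ins-length (there ins) = cong suc (Ins-length ins)

  Ins-member : ∀ {z p q b a} → Ins z p q → b ∈ q → a ∈ b → a ≡ z ⊎ Σ (List (Fin n)) (λ b′ → b′ ∈ p × a ∈ b′)
  Ins-member here (here refl) (here a≡z) = inj₁ a≡z
  Ins-member here (here refl) (there a∈b) = inj₂ (_ , here refl , a∈b)
  Ins-member here (there b∈p) a∈b = inj₂ (_ , there b∈p , a∈b)
  Ins-member (there ins) (here refl) a∈b = inj₂ (_ , here refl , a∈b)
  Ins-member (there ins) (there b∈q) a∈b with Ins-member ins b∈q a∈b
  ... | inj₁ a≡z = inj₁ a≡z
  ... | inj₂ (b′ , b′∈p , a∈b′) = inj₂ (b′ , there b′∈p , a∈b′)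

  IsPartition-⊆ : ∀ {L p b a} → IsPartition L p → b ∈ p → a ∈ b → a ∈ L
  IsPartition-⊆ (singleton isP) (here refl) (here a≡z) = here a≡z
  IsPartition-⊆ (singleton isP) (there b∈p) a∈b = there (IsPartition-⊆ isP b∈p a∈b)
  IsPartition-⊆ (insert isP ins) b∈q a∈b with Ins-member ins b∈q a∈b
  ... | inj₁ a≡z = here a≡z
  ... | inj₂ (b′ , b′∈p , a∈b′) = there (IsPartition-⊆ isP b′∈p a∈b′)

  Ins-proper : ∀ {z p q} → Ins z p q → proper q ≡ true → proper p ≡ true
  Ins-proper {z} (here {b}) prop =
    cong₂ _∧_ (independent-tail z b (∧-conicalˡ _ _ prop)) (∧-conicalʳ (independent G (z ∷ b)) _ prop)
  Ins-proper (there {b} ins) prop =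
    cong₂ _∧_ (∧-conicalˡ _ _ prop) (Ins-proper ins (∧-conicalʳ (independent G b) _ prop))

  neighbours : Fin n → List (Fin n) → ℕ
  neighbours y = sumOver (λ a → indicator (adj G y a))

  free-if-dominated : ∀ y z b → independent G (z ∷ b) ≡ true → adj G y z ≡ true →
    (∀ a → a ∈ b → adj G y a ≡ true → adj G z a ≡ true) → allB (nonadjacent y) b ≡ true
  free-if-dominated y z b indep y~z dominated = allB-intro b nonadj
    where
    nonadj : ∀ a → a ∈ b → nonadjacent y a ≡ true
    nonadj a a∈b with adj G y a in y~a
    ... | false = refl
    ... | true = ⊥-elim (z≁a (allB-∈ (independent-head z b indep) a∈b))
      where
      z≁a : nonadjacent z a ≡ true → ⊥
      z≁a rewrite dominated a a∈b y~a = λ ()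

  -- Putting z into a block: if z is a neighbour of y, the receiving block
  -- was free for y (its neighbours of y would be adjacent to z) and no
  -- longer is; otherwise the free blocks are unchanged.
  freeBlocks-Ins : ∀ y z {p q} → Ins z p q → proper q ≡ true →
    (∀ b → b ∈ p → ∀ a → a ∈ b → adj G y z ≡ true → adj G y a ≡ true → adj G z a ≡ true) →
    freeBlocks y q + indicator (adj G y z) ≡ freeBlocks y p
  freeBlocks-Ins y z (here {b} {p}) prop dominated with adj G y z in y~z
  ... | false = +-identityʳ _
  ... | true rewrite free-if-dominated y z b (∧-conicalˡ _ _ prop) y~z (λ a a∈b → dominated b (here refl) a a∈b refl) =
    +-comm (freeBlocks y p) 1
  freeBlocks-Ins y z (there {b} {p} {q} ins) prop dominated =
    trans (+-assoc (indicator (allB (nonadjacent y) b)) (freeBlocks y q) _)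
      (cong (indicator (allB (nonadjacent y) b) +_)
        (freeBlocks-Ins y z ins (∧-conicalʳ (independent G b) _ prop) (λ b′ b′∈p → dominated b′ (there b′∈p))))

  -- The key count: if the earlier neighbours of y form a clique, then in a
  -- proper partition p of a duplicate-free list L of vertices before y,
  -- each neighbour of y occupies its own block, so
  -- (free blocks) + (neighbours of y in L) = (number of blocks).
  freeBlocks-count : IsPEO G → ∀ y {L p} → Unique L → (∀ a → a ∈ L → toℕ a < toℕ y) →
    IsPartition L p → proper p ≡ true → freeBlocks y p + neighbours y L ≡ length p
  freeBlocks-count peo y unique before nil prop = refl
  freeBlocks-count peo y {z ∷ L} (_ ∷ unique) before (singleton {p = p} isP) prop
    with adj G y z | freeBlocks-count peo y unique (λ a a∈L → before a (there a∈L)) isP (∧-conicalʳ (independent G [ z ]) _ prop)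
  ... | true | count = trans (+-suc (freeBlocks y p) (neighbours y L)) (cong suc count)
  ... | false | count = cong suc count
  freeBlocks-count peo y {z ∷ L} (z∉L ∷ unique) before (insert {p = p} {q = q} isP ins) prop = begin
    freeBlocks y q + (indicator (adj G y z) + neighbours y L)  ≡⟨ +-assoc (freeBlocks y q) _ _ ⟨
    freeBlocks y q + indicator (adj G y z) + neighbours y L    ≡⟨ cong (_+ neighbours y L) (freeBlocks-Ins y z ins prop clique) ⟩
    freeBlocks y p + neighbours y L
      ≡⟨ freeBlocks-count peo y unique (λ a a∈L → before a (there a∈L)) isP (Ins-proper ins prop) ⟩
    length p                                                   ≡⟨ Ins-length ins ⟨
    length q                                                   ∎
    where
    clique : ∀ b → b ∈ p → ∀ a → a ∈ b → adj G y z ≡ true → adj G y a ≡ true → adj G z a ≡ true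
    clique b b∈p a a∈b y~z y~a =
      peo y z a (before z (here refl)) (before a (there a∈L)) y~z y~a (lookup z∉L a∈L)
      where
      a∈L : a ∈ L
      a∈L = IsPartition-⊆ isP b∈p a∈b

  weight : ℕ → Blocks → ℕ
  weight k p = indicator (⌊ length p ℕ.≟ k ⌋ ∧ proper p)

  weight-symmetric : ∀ k → BlockSymmetric (weight k)
  weight-symmetric k p↭q rewrite ↭-length p↭q | allB-↭ (independent G) p↭q = refl

  stirling-sumOver : ∀ m k → stirling G m k ≡ sumOver (weight k) (partitions (vertsUpTo {n} m))
  stirling-sumOver m k = countB-sumOver (λ p → ⌊ length p ℕ.≟ k ⌋ ∧ proper p) (partitions (vertsUpTo m))

  stirling-zero : ∀ k → stirling G 0 k ≡ (if ⌊ 0 ℕ.≟ k ⌋ then 1 else 0)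
  stirling-zero zero rewrite stirling-sumOver 0 zero | vertsUpTo-zero n = refl
  stirling-zero (suc k) rewrite stirling-sumOver 0 (suc k) | vertsUpTo-zero n = refl

  stirlingPred : ℕ → ℕ → ℕ
  stirlingPred m zero = 0
  stirlingPred m (suc k) = stirling G m k

  weightPred : ℕ → Blocks → ℕ
  weightPred zero q = 0
  weightPred (suc k) q = weight k q

  weight-singleton : ∀ y k q → weight k ([ y ] ∷ q) ≡ weightPred k q
  weight-singleton y zero q = refl
  weight-singleton y (suc k) q
    rewrite ≟-suc (length q) k | nonadjacent-self y = refl

  sumOver-weightPred : ∀ m k → sumOver (weightPred k) (partitions (vertsUpTo {n} m)) ≡ stirlingPred m k
  sumOver-weightPred m zero = zero-sum (partitions (vertsUpTo m))
    where
    zero-sum : (ps : List Blocks) → sumOver (λ _ → 0) ps ≡ 0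
    zero-sum [] = refl
    zero-sum (p ∷ ps) = zero-sum ps
  sumOver-weightPred m (suc k) = sym (stirling-sumOver m k)

  -- c_m: the number of neighbours of v_(m+1) among v_1, …, v_m (0 for m ≥ n).
  backDegree : ℕ → ℕ
  backDegree m with m <? n
  ... | yes m<n = neighbours (fromℕ< m<n) (vertsUpTo m)
  ... | no _ = 0

  backDegree-≡ : ∀ m (m<n : m < n) → backDegree m ≡ neighbours (fromℕ< m<n) (vertsUpTo m)
  backDegree-≡ m m<n with m <? n
  ... | yes m<n′ = cong (λ m<n → neighbours (fromℕ< m<n) (vertsUpTo m)) (<-irrelevant m<n′ m<n)
  ... | no m≮n = ⊥-elim (m≮n m<n)

  backDegree-≤ : ∀ m → backDegree m ≤ m
  backDegree-≤ m with m <? n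
  ... | yes m<n = ≤-trans (count-≤-length (adj G (fromℕ< m<n)) (vertsUpTo m))
                          (≤-reflexive (length-vertsUpTo n m (<⇒≤ m<n)))
    where
    count-≤-length : (f : Fin n → Bool) (xs : List (Fin n)) → sumOver (λ a → indicator (f a)) xs ≤ length xs
    count-≤-length f [] = z≤n
    count-≤-length f (x ∷ xs) with f x
    ... | true = s≤s (count-≤-length f xs)
    ... | false = m≤n⇒m≤1+n (count-≤-length f xs)
  ... | no _ = z≤n

  free-plus-backDegree : IsPEO G → ∀ m (m<n : m < n) k q → IsPartition (vertsUpTo {n} m) q →
    indicator (proper q) * freeBlocks (fromℕ< m<n) q * indicator ⌊ length q ℕ.≟ k ⌋ +
      neighbours (fromℕ< m<n) (vertsUpTo m) * weight k q ≡ k * weight k q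
  free-plus-backDegree peo m m<n k q isP with proper q in prop
  ... | false rewrite ∧-zeroʳ ⌊ length q ℕ.≟ k ⌋ | *-zeroʳ (neighbours (fromℕ< m<n) (vertsUpTo m)) | *-zeroʳ k = refl
  ... | true with length q ℕ.≟ k
  ...   | yes refl = trans (simplify (freeBlocks y q) (neighbours y (vertsUpTo m)))
                       (cong (_* 1) (freeBlocks-count peo y (vertsUpTo-unique n m) (vertsUpTo-precede n m m<n) isP prop))
    where
    y : Fin n
    y = fromℕ< m<n
    simplify : ∀ f c → 1 * f * 1 + c * 1 ≡ (f + c) * 1
    simplify = solve-∀
  ...   | no _ = vanish (1 * freeBlocks (fromℕ< m<n) q) (neighbours (fromℕ< m<n) (vertsUpTo m)) k
    where
    vanish : ∀ a c k → a * 0 + c * 0 ≡ k * 0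
    vanish = solve-∀

  joined-count : IsPEO G → ∀ m (m<n : m < n) k →
    sumOver (λ q → sumOver (weight k) (appendEach (fromℕ< m<n) q)) (partitions (vertsUpTo m))
      + neighbours (fromℕ< m<n) (vertsUpTo m) * stirling G m k ≡ k * stirling G m k
  joined-count peo m m<n k = begin
    sumOver (λ q → sumOver (weight k) (appendEach y q)) (partitions V) + c * stirling G m k
      ≡⟨ cong₂ _+_
           (sumOver-cong (λ q → trans (sumOver-cong factor (appendEach y q))
                                      (appendEach-proper y (λ l → indicator ⌊ l ℕ.≟ k ⌋) q)) (partitions V))
           (trans (cong (c *_) (stirling-sumOver m k)) (sym (sumOver-* c (weight k) (partitions V)))) ⟩
    sumOver (λ q → indicator (proper q) * freeBlocks y q * indicator ⌊ length q ℕ.≟ k ⌋) (partitions V) +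
      sumOver (λ q → c * weight k q) (partitions V)
      ≡⟨ sumOver-+ _ _ (partitions V) ⟨
    sumOver (λ q → indicator (proper q) * freeBlocks y q * indicator ⌊ length q ℕ.≟ k ⌋ + c * weight k q) (partitions V)
      ≡⟨ sumOver-partitions-cong V (free-plus-backDegree peo m m<n k) ⟩
    sumOver (λ q → k * weight k q) (partitions V)
      ≡⟨ sumOver-* k (weight k) (partitions V) ⟩
    k * sumOver (weight k) (partitions V)
      ≡⟨ cong (k *_) (stirling-sumOver m k) ⟨
    k * stirling G m k ∎
    where
    y : Fin n
    y = fromℕ< m<n
    V : List (Fin n)
    V = vertsUpTo m
    c : ℕ
    c = neighbours y V
    factor : ∀ q → weight k q ≡ indicator (proper q) * indicator ⌊ length q ℕ.≟ k ⌋
    factor q = trans (indicator-∧ ⌊ length q ℕ.≟ k ⌋ (proper q)) (*-comm _ (indicator (proper q)))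

  singleton-count : ∀ m y k → sumOver (λ q → weight k ([ y ] ∷ q)) (partitions (vertsUpTo {n} m)) ≡ stirlingPred m k
  singleton-count m y k = trans (sumOver-cong (weight-singleton y k) (partitions (vertsUpTo m))) (sumOver-weightPred m k)

  -- The recurrence {G_(m+1) brace k} = {G_m brace k-1} + (k - c_m) {G_m brace k},
  -- stated without subtraction.
  stirling-recurrence : IsPEO G → ∀ m → m < n → ∀ k →
    stirling G (suc m) k + backDegree m * stirling G m k ≡ stirlingPred m k + k * stirling G m k
  stirling-recurrence peo m m<n k = begin
    stirling G (suc m) k + backDegree m * stirling G m k
      ≡⟨ cong₂ (λ u v → u + v * stirling G m k) (stirling-sumOver (suc m) k) (backDegree-≡ m m<n) ⟩
    sumOver (weight k) (partitions (vertsUpTo (suc m))) + c * stirling G m k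
      ≡⟨ cong (λ L → sumOver (weight k) (partitions L) + c * stirling G m k) (vertsUpTo-snoc n m m<n) ⟩
    sumOver (weight k) (partitions (V ++ [ y ])) + c * stirling G m k
      ≡⟨ cong (_+ c * stirling G m k) (trans (partitions-snoc V y (weight-symmetric k)) (sumOver-+ _ _ (partitions V))) ⟩
    (singletons + joined) + c * stirling G m k
      ≡⟨ +-assoc singletons joined (c * stirling G m k) ⟩
    singletons + (joined + c * stirling G m k)
      ≡⟨ cong₂ _+_ (singleton-count m y k) (joined-count peo m m<n k) ⟩
    stirlingPred m k + k * stirling G m k ∎
    where
    y : Fin n
    y = fromℕ< m<n
    V : List (Fin n)
    V = vertsUpTo m
    c singletons joined : ℕ
    c = neighbours y V
    singletons = sumOver (λ q → weight k ([ y ] ∷ q)) (partitions V)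
    joined = sumOver (λ q → sumOver (weight k) (appendEach y q)) (partitions V)

module IntegerMatrices where

  open import Data.Bool using (if_then_else_)
  open import Data.Nat using (zero; suc)
  open import Data.Fin using (Fin; toℕ) renaming (zero to fzero; suc to fsuc)
  open import Data.Integer using (ℤ; 0ℤ; 1ℤ; _+_; _*_)
  open import Data.Integer.Properties as ℤP using (+-*-semiring)
  open import Algebra.Properties.Semiring.Sum +-*-semiring
    using (sum; sum-cong-≗; ∑-distrib-+; ∑-comm; *-distribˡ-sum; *-distribʳ-sum)
  open import Relation.Binary.PropositionalEquality
    using (_≡_; refl; sym; trans; cong; cong₂; module ≡-Reasoning)
  open ≡-Reasoning
  open NatEquality

  sumFin≡sum : ∀ {N} (f : Fin N → ℤ) → sumFin f ≡ sum f
  sumFin≡sum {zero} f = refl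
  sumFin≡sum {suc N} f = cong (f fzero +_) (sumFin≡sum (λ i → f (fsuc i)))

  sumFin-cong : ∀ {N} {f g : Fin N → ℤ} → (∀ i → f i ≡ g i) → sumFin f ≡ sumFin g
  sumFin-cong {f = f} {g} f≗g = trans (sumFin≡sum f) (trans (sum-cong-≗ f≗g) (sym (sumFin≡sum g)))

  sumFin-+ : ∀ {N} (f g : Fin N → ℤ) → sumFin (λ i → f i + g i) ≡ sumFin f + sumFin g
  sumFin-+ f g = trans (sumFin≡sum (λ i → f i + g i)) (trans (∑-distrib-+ f g) (sym (cong₂ _+_ (sumFin≡sum f) (sumFin≡sum g))))

  sumFin-*ˡ : ∀ {N} (a : ℤ) (f : Fin N → ℤ) → sumFin (λ i → a * f i) ≡ a * sumFin f
  sumFin-*ˡ a f = trans (sumFin≡sum (λ i → a * f i)) (trans (sym (*-distribˡ-sum a f)) (cong (a *_) (sym (sumFin≡sum f))))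

  sumFin-*ʳ : ∀ {N} (a : ℤ) (f : Fin N → ℤ) → sumFin (λ i → f i * a) ≡ sumFin f * a
  sumFin-*ʳ a f = trans (sumFin≡sum (λ i → f i * a)) (trans (sym (*-distribʳ-sum a f)) (cong (_* a) (sym (sumFin≡sum f))))

  sumFin-comm : ∀ {M N} (f : Fin M → Fin N → ℤ) →
    sumFin (λ i → sumFin (λ j → f i j)) ≡ sumFin (λ j → sumFin (λ i → f i j))
  sumFin-comm f = begin
    sumFin (λ i → sumFin (λ j → f i j)) ≡⟨ sumFin-cong (λ i → sumFin≡sum (f i)) ⟩
    sumFin (λ i → sum (λ j → f i j))    ≡⟨ sumFin≡sum (λ i → sum (λ j → f i j)) ⟩
    sum (λ i → sum (λ j → f i j))       ≡⟨ ∑-comm f ⟩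
    sum (λ j → sum (λ i → f i j))       ≡⟨ sumFin≡sum (λ j → sum (λ i → f i j)) ⟨
    sumFin (λ j → sum (λ i → f i j))    ≡⟨ sumFin-cong (λ j → sumFin≡sum (λ i → f i j)) ⟨
    sumFin (λ j → sumFin (λ i → f i j)) ∎

  ⊗-assoc : ∀ {N} (A B C : Fin N → Fin N → ℤ) i j → ((A ⊗ B) ⊗ C) i j ≡ (A ⊗ (B ⊗ C)) i j
  ⊗-assoc A B C i j = begin
    sumFin (λ l → sumFin (λ p → A i p * B p l) * C l j)
      ≡⟨ sumFin-cong (λ l → sumFin-*ʳ (C l j) (λ p → A i p * B p l)) ⟨
    sumFin (λ l → sumFin (λ p → A i p * B p l * C l j))
      ≡⟨ sumFin-comm (λ l p → A i p * B p l * C l j) ⟩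
    sumFin (λ p → sumFin (λ l → A i p * B p l * C l j))
      ≡⟨ sumFin-cong (λ p → trans (sumFin-cong (λ l → ℤP.*-assoc (A i p) (B p l) (C l j)))
                                  (sumFin-*ˡ (A i p) (λ l → B p l * C l j))) ⟩
    sumFin (λ p → A i p * sumFin (λ l → B p l * C l j)) ∎

  sumFin-zero : ∀ N → sumFin {N} (λ _ → 0ℤ) ≡ 0ℤ
  sumFin-zero zero = refl
  sumFin-zero (suc N) = trans (ℤP.+-identityˡ _) (sumFin-zero N)

  idM-suc : ∀ {N} (i j : Fin N) → idM {suc N} (fsuc i) (fsuc j) ≡ idM i j
  idM-suc i j = cong (λ b → if b then 1ℤ else 0ℤ) (≟-suc (toℕ i) (toℕ j))

  idM-⊗ : ∀ {N} (i : Fin N) (v : Fin N → ℤ) → sumFin (λ l → idM i l * v l) ≡ v i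
  idM-⊗ {suc N} fzero v = begin
    1ℤ * v fzero + sumFin (λ l → 0ℤ * v (fsuc l))
      ≡⟨ cong₂ _+_ (ℤP.*-identityˡ (v fzero)) (trans (sumFin-cong (λ l → ℤP.*-zeroˡ (v (fsuc l)))) (sumFin-zero N)) ⟩
    v fzero + 0ℤ ≡⟨ ℤP.+-identityʳ (v fzero) ⟩
    v fzero ∎
  idM-⊗ {suc N} (fsuc i) v = begin
    0ℤ * v fzero + sumFin (λ l → idM (fsuc i) (fsuc l) * v (fsuc l))
      ≡⟨ cong₂ _+_ (ℤP.*-zeroˡ (v fzero)) (sumFin-cong (λ l → cong (_* v (fsuc l)) (idM-suc i l))) ⟩
    0ℤ + sumFin (λ l → idM i l * v (fsuc l)) ≡⟨ ℤP.+-identityˡ _ ⟩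
    sumFin (λ l → idM i l * v (fsuc l)) ≡⟨ idM-⊗ i (λ l → v (fsuc l)) ⟩
    v (fsuc i) ∎

  ⊗-idM : ∀ {N} (j : Fin N) (v : Fin N → ℤ) → sumFin (λ l → v l * idM l j) ≡ v j
  ⊗-idM j v = trans (sumFin-cong (λ l → trans (ℤP.*-comm (v l) (idM l j)) (cong (_* v l) (idM-sym l j)))) (idM-⊗ j v)
    where
    idM-sym : ∀ {N} (l j : Fin N) → idM l j ≡ idM j l
    idM-sym {suc N} fzero fzero = refl
    idM-sym {suc N} fzero (fsuc j) = refl
    idM-sym {suc N} (fsuc l) fzero = refl
    idM-sym {suc N} (fsuc l) (fsuc j) = trans (idM-suc l j) (trans (idM-sym l j) (sym (idM-suc j l)))

  left-inverse≡right-inverse : ∀ {N} (T A s : Fin N → Fin N → ℤ) →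
    (∀ i j → (T ⊗ A) i j ≡ idM i j) → (∀ i j → (A ⊗ s) i j ≡ idM i j) → ∀ i j → s i j ≡ T i j
  left-inverse≡right-inverse T A s TA≡I As≡I i j = begin
    s i j                            ≡⟨ idM-⊗ i (λ l → s l j) ⟨
    sumFin (λ l → idM i l * s l j)   ≡⟨ sumFin-cong (λ l → cong (_* s l j) (TA≡I i l)) ⟨
    ((T ⊗ A) ⊗ s) i j                ≡⟨ ⊗-assoc T A s i j ⟩
    sumFin (λ l → T i l * (A ⊗ s) l j) ≡⟨ sumFin-cong (λ l → cong (T i l *_) (As≡I l j)) ⟩
    sumFin (λ l → T i l * idM l j)   ≡⟨ ⊗-idM j (T i) ⟩
    T i j                            ∎

module Rows where

  open import Data.Bool using (if_then_else_)
  open import Data.Nat as ℕ using (ℕ; zero; suc; _<_)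
  open import Data.Fin using (toℕ)
  open import Data.Fin.Properties using (toℕ<n)
  open import Data.Integer using (ℤ; +_; 0ℤ; 1ℤ; _+_; _-_; _*_)
  import Data.Integer.Properties as ℤP
  open import Relation.Nullary using (yes; no)
  open import Relation.Nullary.Decidable using (⌊_⌋)
  open import Relation.Binary.PropositionalEquality using (_≡_; refl; sym; trans; cong)
  open IntegerMatrices using (sumFin-cong; sumFin-+; sumFin-*ˡ; sumFin-zero)
  open NatEquality

  δ : ℕ → ℕ → ℤ
  δ m j = if ⌊ m ℕ.≟ j ⌋ then 1ℤ else 0ℤ

  shift : (ℕ → ℤ) → ℕ → ℤ
  shift f zero = 0ℤ
  shift f (suc k) = f k

  shift-cong : ∀ {f g : ℕ → ℤ} → (∀ k → f k ≡ g k) → ∀ k → shift f k ≡ shift g k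
  shift-cong f≗g zero = refl
  shift-cong f≗g (suc k) = f≗g k

  δ-suc : ∀ m j → δ (suc m) j ≡ shift (δ m) j + (+ j - + m) * δ m j
  δ-suc m j = sym (trans (cong (λ z → shift (δ m) j + z) (diagonal-vanishes m j)) (shifted j))
    where
    diagonal-vanishes : ∀ m j → (+ j - + m) * δ m j ≡ 0ℤ
    diagonal-vanishes m j with m ℕ.≟ j
    ... | yes refl = cong (_* 1ℤ) (ℤP.+-inverseʳ (+ m))
    ... | no _ = ℤP.*-zeroʳ (+ j - + m)
    shifted : ∀ j → shift (δ m) j + 0ℤ ≡ δ (suc m) j
    shifted zero = refl
    shifted (suc j) = trans (ℤP.+-identityʳ (δ m j)) (cong (λ b → if b then 1ℤ else 0ℤ) (sym (≟-suc m j)))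

  σ : ℕ → (ℕ → ℤ) → ℤ
  σ N f = sumFin {N} (λ i → f (toℕ i))

  σ-cong : ∀ N {f g : ℕ → ℤ} → (∀ k → k < N → f k ≡ g k) → σ N f ≡ σ N g
  σ-cong N f≗g = sumFin-cong (λ i → f≗g (toℕ i) (toℕ<n i))

  σ-+ : ∀ N (f g : ℕ → ℤ) → σ N (λ k → f k + g k) ≡ σ N f + σ N g
  σ-+ N f g = sumFin-+ {N} (λ i → f (toℕ i)) (λ i → g (toℕ i))

  σ-*ˡ : ∀ N (a : ℤ) (f : ℕ → ℤ) → σ N (λ k → a * f k) ≡ a * σ N f
  σ-*ˡ N a f = sumFin-*ˡ {N} a (λ i → f (toℕ i))

  σ-zero : ∀ N → σ N (λ _ → 0ℤ) ≡ 0ℤ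
  σ-zero N = sumFin-zero N

  σ-snoc : ∀ N (f : ℕ → ℤ) → σ (suc N) f ≡ σ N f + f N
  σ-snoc zero f = trans (ℤP.+-identityʳ (f 0)) (sym (ℤP.+-identityˡ (f 0)))
  σ-snoc (suc N) f = trans (cong (λ z → f 0 + z) (σ-snoc N (λ k → f (suc k)))) (sym (ℤP.+-assoc (f 0) _ _))

-- For c : ℕ → ℕ,
-- if S(0,k) = δ(0,k) and S(m+1,k) = S(m,k-1) + (k - c_m) S(m,k), then the
-- matrix T with T(0,k) = δ(0,k), T(m+1,k) = T(m,k-1) + (c_k - m) T(m,k) is
-- a left inverse of S.  (In polynomial terms, S writes P_m = ∏_{i<m} (x - c_i)
-- in falling factorials (x)_k, and T writes (x)_m in the P_k.)  When
-- c_k ≤ k, every step of the recurrence for T has sign (-1), so T(m,k)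
-- has sign (-1)^(m-k).
module RecurrenceInverse (c : ℕ → ℕ) where

  open import Data.Nat as ℕ using (zero; suc; _<_; _≤_; _∸_; z≤n; s≤s; _≤?_)
  open import Data.Nat.Properties using (≤-trans; m≤n⇒m≤1+n; <⇒≤; ≰⇒>; +-∸-assoc; m≤n⇒∣n-m∣≡n∸m)
  open import Data.Integer using (ℤ; +_; +≤+; 0ℤ; 1ℤ; -1ℤ; _+_; _-_; _*_; _^_)
  open import Data.Integer as ℤ using ()
  import Data.Integer.Properties as ℤP
  open import Data.Integer.Tactic.RingSolver using (solve-∀)
  open import Relation.Nullary using (yes; no)
  open import Relation.Binary.PropositionalEquality
    using (_≡_; refl; sym; trans; cong; cong₂; module ≡-Reasoning)
  open ≡-Reasoning
  open Rows

  t : ℕ → ℕ → ℤ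
  t zero k = δ 0 k
  t (suc m) k = shift (t m) k + (+ c k - + m) * t m k

  t-upper : ∀ m k → m < k → t m k ≡ 0ℤ
  t-upper zero (suc k) _ = refl
  t-upper (suc m) (suc k) (s≤s m<k)
    rewrite t-upper m k m<k | t-upper m (suc k) (m≤n⇒m≤1+n m<k) =
    trans (ℤP.+-identityˡ _) (ℤP.*-zeroʳ (+ c (suc k) - + m))

  module LeftInverse (N : ℕ) (S : ℕ → ℕ → ℤ)
    (S-zero : ∀ k → S 0 k ≡ δ 0 k)
    (S-suc : ∀ m → m < N → ∀ k → S (suc m) k ≡ shift (S m) k + (+ k - + c m) * S m k) where

    TS : ℕ → ℕ → ℤ
    TS m j = σ (suc N) (λ k → t m k * S k j)

    shifted-column : ∀ m j → σ (suc N) (λ k → t m k * shift (S k) j) ≡ shift (TS m) j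
    shifted-column m zero = trans (σ-cong (suc N) (λ k _ → ℤP.*-zeroʳ (t m k))) (σ-zero (suc N))
    shifted-column m (suc j) = refl

    -- The shifted row T(m,k-1) meets the rows S(k+1,·) = S(k,·-1) + (· - c_k) S(k,·)
    -- of S; the extra term at k = N vanishes because T(m,N) = 0 for m < N.
    lower-rows : ∀ m → m < N → ∀ j →
      σ (suc N) (λ k → shift (t m) k * S k j) ≡
      σ (suc N) (λ k → t m k * shift (S k) j) + σ (suc N) (λ k → (+ j - + c k) * (t m k * S k j))
    lower-rows m m<N j = begin
      0ℤ * S 0 j + σ N (λ k → t m k * S (suc k) j)
        ≡⟨ trans (cong (_+ σ N (λ k → t m k * S (suc k) j)) (ℤP.*-zeroˡ (S 0 j))) (ℤP.+-identityˡ _) ⟩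
      σ N (λ k → t m k * S (suc k) j)
        ≡⟨ σ-cong N (λ k k<N → trans (cong (t m k *_) (S-suc k k<N j))
                                     (distribute (t m k) (shift (S k) j) (+ j - + c k) (S k j))) ⟩
      σ N (λ k → A k + B k)
        ≡⟨ ℤP.+-identityʳ _ ⟨
      σ N (λ k → A k + B k) + 0ℤ
        ≡⟨ cong (λ z → σ N (λ k → A k + B k) + z) last-row-vanishes ⟨
      σ N (λ k → A k + B k) + (A N + B N)
        ≡⟨ σ-snoc N (λ k → A k + B k) ⟨
      σ (suc N) (λ k → A k + B k)
        ≡⟨ σ-+ (suc N) A B ⟩
      σ (suc N) A + σ (suc N) B ∎
      where
      A B : ℕ → ℤ
      A k = t m k * shift (S k) j
      B k = (+ j - + c k) * (t m k * S k j)
      distribute : ∀ x a b y → x * (a + b * y) ≡ x * a + b * (x * y)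
      distribute = solve-∀
      vanish : ∀ a b s → 0ℤ * a + b * (0ℤ * s) ≡ 0ℤ
      vanish = solve-∀
      last-row-vanishes : A N + B N ≡ 0ℤ
      last-row-vanishes rewrite t-upper m N m<N = vanish (shift (S N) j) (+ j - + c N) (S N j)

    -- Entrywise form of T(m+1,·) S = shift (T(m,·) S) + (· - m) T(m,·) S,
    -- i.e. the rows of T S satisfy the recurrence of δ.
    TS-suc : ∀ m → m < N → ∀ j → TS (suc m) j ≡ shift (TS m) j + (+ j - + m) * TS m j
    TS-suc m m<N j = begin
      σ (suc N) (λ k → (shift (t m) k + (+ c k - + m) * t m k) * S k j)
        ≡⟨ σ-cong (suc N) (λ k _ → expand (shift (t m) k) (+ c k - + m) (t m k) (S k j)) ⟩
      σ (suc N) (λ k → shift (t m) k * S k j + C k)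
        ≡⟨ σ-+ (suc N) (λ k → shift (t m) k * S k j) C ⟩
      σ (suc N) (λ k → shift (t m) k * S k j) + σ (suc N) C
        ≡⟨ cong (_+ σ (suc N) C) (lower-rows m m<N j) ⟩
      (σ (suc N) A + σ (suc N) B) + σ (suc N) C
        ≡⟨ ℤP.+-assoc (σ (suc N) A) (σ (suc N) B) (σ (suc N) C) ⟩
      σ (suc N) A + (σ (suc N) B + σ (suc N) C)
        ≡⟨ cong₂ _+_ (shifted-column m j) (sym (σ-+ (suc N) B C)) ⟩
      shift (TS m) j + σ (suc N) (λ k → B k + C k)
        ≡⟨ cong (λ z → shift (TS m) j + z) (trans (σ-cong (suc N) (λ k _ → telescope (+ j) (+ c k) (+ m) (X k)))
                                                   (σ-*ˡ (suc N) (+ j - + m) X)) ⟩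
      shift (TS m) j + (+ j - + m) * TS m j ∎
      where
      X A B C : ℕ → ℤ
      X k = t m k * S k j
      A k = t m k * shift (S k) j
      B k = (+ j - + c k) * X k
      C k = (+ c k - + m) * X k
      expand : ∀ a b x y → (a + b * x) * y ≡ a * y + b * (x * y)
      expand = solve-∀
      telescope : ∀ j c m x → (j - c) * x + (c - m) * x ≡ (j - m) * x
      telescope = solve-∀

    t-leftInverse : ∀ m → m ≤ N → ∀ j → TS m j ≡ δ m j
    t-leftInverse zero _ j = begin
      1ℤ * S 0 j + σ N (λ k → 0ℤ * S (suc k) j)
        ≡⟨ cong₂ _+_ (ℤP.*-identityˡ (S 0 j)) (trans (σ-cong N (λ k _ → ℤP.*-zeroˡ (S (suc k) j))) (σ-zero N)) ⟩
      S 0 j + 0ℤ ≡⟨ ℤP.+-identityʳ (S 0 j) ⟩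
      S 0 j ≡⟨ S-zero j ⟩
      δ 0 j ∎
    t-leftInverse (suc m) m<N j = begin
      TS (suc m) j                              ≡⟨ TS-suc m m<N j ⟩
      shift (TS m) j + (+ j - + m) * TS m j
        ≡⟨ cong₂ _+_ (shift-cong (t-leftInverse m (<⇒≤ m<N)) j) (cong ((+ j - + m) *_) (t-leftInverse m (<⇒≤ m<N) j)) ⟩
      shift (δ m) j + (+ j - + m) * δ m j       ≡⟨ δ-suc m j ⟨
      δ (suc m) j                               ∎

  nonneg-+ : ∀ {a b} → 0ℤ ℤ.≤ a → 0ℤ ℤ.≤ b → 0ℤ ℤ.≤ a + b
  nonneg-+ = ℤP.+-mono-≤

  nonneg-* : ∀ {a b} → 0ℤ ℤ.≤ a → 0ℤ ℤ.≤ b → 0ℤ ℤ.≤ a * b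
  nonneg-* {+ x} {+ y} _ _ rewrite sym (ℤP.pos-* x y) = +≤+ z≤n

  t-sign : (∀ k → c k ≤ k) → ∀ m k → k ≤ m → 0ℤ ℤ.≤ (-1ℤ ^ (m ∸ k)) * t m k
  t-sign c≤ zero zero _ = +≤+ z≤n
  t-sign c≤ (suc m) k k≤1+m
    rewrite ℤP.*-distribˡ-+ (-1ℤ ^ (suc m ∸ k)) (shift (t m) k) ((+ c k - + m) * t m k) =
    nonneg-+ (from-previous-column k k≤1+m) from-same-column
    where
    from-previous-column : ∀ k → k ≤ suc m → 0ℤ ℤ.≤ (-1ℤ ^ (suc m ∸ k)) * shift (t m) k
    from-previous-column zero _ rewrite ℤP.*-zeroʳ (-1ℤ ^ suc m) = +≤+ z≤n
    from-previous-column (suc k) (s≤s k≤m) = t-sign c≤ m k k≤m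
    -- c_k - m ≤ 0 flips the sign exactly once.
    flip : ∀ s x c m → (-1ℤ * s) * ((c - m) * x) ≡ (m - c) * (s * x)
    flip = solve-∀
    from-same-column : 0ℤ ℤ.≤ (-1ℤ ^ (suc m ∸ k)) * ((+ c k - + m) * t m k)
    from-same-column with k ≤? m
    ... | yes k≤m rewrite +-∸-assoc 1 k≤m | flip (-1ℤ ^ (m ∸ k)) (t m k) (+ c k) (+ m) =
      nonneg-* (ℤP.i≤j⇒0≤j-i (+≤+ (≤-trans (c≤ k) k≤m))) (t-sign c≤ m k k≤m)
    ... | no k≰m rewrite t-upper m k (≰⇒> k≰m) | ℤP.*-zeroʳ (+ c k - + m) | ℤP.*-zeroʳ (-1ℤ ^ (suc m ∸ k)) =
      +≤+ z≤n

  t-alternating : (∀ k → c k ≤ k) → ∀ m k → 0ℤ ℤ.≤ (-1ℤ ^ ℕ.∣ m - k ∣) * t m k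
  t-alternating c≤ m k with k ≤? m
  ... | yes k≤m rewrite m≤n⇒∣n-m∣≡n∸m k≤m = t-sign c≤ m k k≤m
  ... | no k≰m rewrite t-upper m k (≰⇒> k≰m) | ℤP.*-zeroʳ (-1ℤ ^ ℕ.∣ m - k ∣) = +≤+ z≤n

module GraphStirlingMatrix {n : ℕ} (G : Graph n) (peo : IsPEO G) where

  open import Data.Nat as ℕ using (zero; suc; _<_)
  open import Data.Integer using (ℤ; +_; _+_; _-_; _*_)
  import Data.Integer.Properties as ℤP
  open import Data.Integer.Tactic.RingSolver using (solve-∀)
  open import Relation.Binary.PropositionalEquality using (_≡_; refl; cong; cong₂; module ≡-Reasoning)
  open ≡-Reasoning
  open StirlingRecurrence G using (stirling-zero; stirling-recurrence; stirlingPred; backDegree)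
  open Rows using (δ; shift)
  open RecurrenceInverse (StirlingRecurrence.backDegree G) using (t)
  open IntegerMatrices using (left-inverse≡right-inverse)
  open import Data.Fin using (toℕ)
  open import Data.Fin.Properties using (toℕ≤pred[n])
  open import Data.Product using (proj₁)

  Srow : ℕ → ℕ → ℤ
  Srow m k = + stirling G m k

  Srow-zero : ∀ k → Srow 0 k ≡ δ 0 k
  Srow-zero zero = cong +_ (stirling-zero zero)
  Srow-zero (suc k) = cong +_ (stirling-zero (suc k))

  Srow-suc : ∀ m → m < n → ∀ k → Srow (suc m) k ≡ shift (Srow m) k + (+ k - + backDegree m) * Srow m k
  Srow-suc m m<n k = begin
    x                  ≡⟨ cancel x c s ⟩
    (x + c * s) - c * s ≡⟨ cong (_- c * s) lifted ⟩
    (p + + k * s) - c * s ≡⟨ regroup p (+ k) c s ⟩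
    p + (+ k - c) * s   ∎
    where
    x c s p : ℤ
    x = Srow (suc m) k
    c = + backDegree m
    s = Srow m k
    p = shift (Srow m) k
    shift-pred : ∀ k → + stirlingPred m k ≡ shift (Srow m) k
    shift-pred zero = refl
    shift-pred (suc k) = refl
    lifted : x + c * s ≡ p + + k * s
    lifted = begin
      x + c * s ≡⟨ cong (λ z → x + z) (ℤP.pos-* (backDegree m) (stirling G m k)) ⟨
      + (stirling G (suc m) k ℕ.+ backDegree m ℕ.* stirling G m k) ≡⟨ cong +_ (stirling-recurrence peo m m<n k) ⟩
      + (stirlingPred m k ℕ.+ k ℕ.* stirling G m k) ≡⟨ ℤP.pos-+ (stirlingPred m k) (k ℕ.* stirling G m k) ⟩
      + stirlingPred m k + + (k ℕ.* stirling G m k) ≡⟨ cong₂ _+_ (shift-pred k) (ℤP.pos-* k (stirling G m k)) ⟩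
      p + + k * s ∎
    cancel : ∀ x c s → x ≡ (x + c * s) - c * s
    cancel = solve-∀
    regroup : ∀ p k c s → (p + k * s) - c * s ≡ p + (k - c) * s
    regroup = solve-∀

  open RecurrenceInverse.LeftInverse backDegree n Srow Srow-zero Srow-suc using (t-leftInverse)


  inverse≡t : ∀ s → IsInverse (S G) s → ∀ i j → s i j ≡ t (toℕ i) (toℕ j)
  inverse≡t s inverse = left-inverse≡right-inverse (λ i j → t (toℕ i) (toℕ j)) (S G) s
    (λ i j → t-leftInverse (toℕ i) (toℕ≤pred[n] i) (toℕ j)) (proj₁ inverse)

open import Data.Nat using (suc; ∣_-_∣)
open import Data.Fin using (Fin; toℕ)
open import Data.Integer using (ℤ; _*_; _≤_; 0ℤ; -1ℤ; _^_)
open import Relation.Binary.PropositionalEquality using (_≡_; subst; sym)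

-- The inverse of S_G is the matrix T of RecurrenceInverse for the
-- back-degrees c_k ≤ k, whose entries alternate in sign.
theorem2p1 : (n : ℕ) (G : Graph n) → Chordal G → IsPEO G →
    (s : Fin (suc n) → Fin (suc n) → ℤ) → IsInverse (S G) s →
    ∀ (m k : Fin (suc n)) → 0ℤ ≤ (-1ℤ ^ ∣ toℕ m - toℕ k ∣) * s m k
theorem2p1 n G _ peo s inverse m k =
  subst (λ x → 0ℤ ≤ (-1ℤ ^ ∣ toℕ m - toℕ k ∣) * x) (sym (s≡t m k)) (t-alternating backDegree-≤ (toℕ m) (toℕ k))
  where
  open StirlingRecurrence G using (backDegree; backDegree-≤)
  open RecurrenceInverse backDegree using (t; t-alternating)
  s≡t : ∀ i j → s i j ≡ t (toℕ i) (toℕ j)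
  s≡t = GraphStirlingMatrix.inverse≡t G peo s inverse
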